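{- For a map $f:\mathbb{N}\to\mathbb{N}$ the following are equivalent: (1) $f$ is congruence preserving on the algebra $\langle\mathbb{N};+\rangle$; (2) (i) $x-y$ divides $f(x)-f(y)$ for all $x,y\in\mathbb{N}$, and (ii) either $f$ is constant or $f(x)\geq x$ for all $x\in\mathbb{N}$.
   Context: A congruence on $\langle\mathbb{N};+\rangle$ is an equivalence relation $\sim$ on $\mathbb{N}$ such that $x\sim y$ and $x'\sim y'$ imply $x+x'\sim y+y'$. A function $f:\mathbb{N}\to\mathbb{N}$ is congruence preserving if for every such congruence $\sim$, $x\sim y$ implies $f(x)\sim f(y)$. -}

module Defs where

open import Data.Nat using (ℕ; _+_; _≥_)
open import Data.Integer using (ℤ; +_; _-_)
open import Data.Integer.Divisibility using (_∣_)
open import Data.Product using (_×_)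
open import Data.Sum using (_⊎_)
open import Relation.Binary.Core using (Rel)
open import Relation.Binary.Structures using (IsEquivalence)
open import Relation.Binary.PropositionalEquality using (_≡_)
open import Level using (0ℓ)

record IsCongruence (_∼_ : Rel ℕ 0ℓ) : Set where
  field
    isEquivalence : IsEquivalence _∼_
    +-compat : ∀ {x y x′ y′} → x ∼ y → x′ ∼ y′ → (x + x′) ∼ (y + y′)

CongruencePreserving : (ℕ → ℕ) → Set₁
CongruencePreserving f =
  (_∼_ : Rel ℕ 0ℓ) → IsCongruence _∼_ → ∀ x y → x ∼ y → f x ∼ f y

DiffDivides : (ℕ → ℕ) → Set
DiffDivides f = ∀ x y → (+ x - + y) ∣ (+ f x - + f y)

IsConstant : (ℕ → ℕ) → Set
IsConstant f = ∀ x y → f x ≡ f y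

Condition2 : (ℕ → ℕ) → Set
Condition2 f = DiffDivides f × (IsConstant f ⊎ (∀ x → f x ≥ x))

-- Congruence modulo x − y gives x − y ∣ f x − f y.
-- The congruence identifying all numbers ≥ t makes f constant on [t, ∞) as soon as f t < t,
-- and the divisibility condition, applied with differences larger than any value gap, spreads
-- that constancy to all of ℕ. Conversely, a congruence with x ∼ x + d identifies any u, v ≥ x
-- with d ∣ u − v; when f x ≥ x this applies to u = f x and v = f (x + d).
module Submission where

open import Defs
open import Data.Nat using (ℕ; zero; suc; _+_; _*_; _∸_; _≤_; _<_; _≥_; _⊔_; ∣_-_∣; s≤s)
open import Data.Nat.Properties
open import Data.Nat.Divisibility using (_∣_; divides; >⇒∤)
import Data.Integer as ℤ
open ℤ using (ℤ; +_)
import Data.Integer.Properties as ℤ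
import Data.Integer.Divisibility.Signed as ℤ∣
open import Data.Integer.Tactic.RingSolver using (solve-∀)
open import Algebra.Properties.CommutativeSemigroup +-commutativeSemigroup using (xy∙z≈xz∙y)
open import Data.Product using (_×_; _,_; swap)
open import Data.Sum using (_⊎_; inj₁; inj₂; map)
open import Function.Base using (_∘′_)
open import Function.Bundles using (_⇔_; mk⇔)
open import Relation.Nullary using (yes; no; contradiction)
open import Relation.Binary.Core using (Rel)
open import Relation.Binary.Structures using (IsEquivalence)
open import Relation.Binary.PropositionalEquality
  using (_≡_; refl; sym; trans; cong; cong₂; subst; subst₂; module ≡-Reasoning)
open import Level using (0ℓ)

m≤n⇒∣+m-+n∣≡∣m-n∣ : ∀ {m n} → m ≤ n → ℤ.∣ + m ℤ.- + n ∣ ≡ ∣ m - n ∣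
m≤n⇒∣+m-+n∣≡∣m-n∣ {m} {n} m≤n = begin
  ℤ.∣ + m ℤ.- + n ∣ ≡⟨ cong ℤ.∣_∣ (ℤ.[+m]-[+n]≡m⊖n m n) ⟩
  ℤ.∣ m ℤ.⊖ n ∣     ≡⟨ ℤ.∣⊖∣-≤ m≤n ⟩
  n ∸ m             ≡⟨ m≤n⇒∣m-n∣≡n∸m m≤n ⟨
  ∣ m - n ∣         ∎
  where open ≡-Reasoning

∣+m-+n∣≡∣m-n∣ : ∀ m n → ℤ.∣ + m ℤ.- + n ∣ ≡ ∣ m - n ∣
∣+m-+n∣≡∣m-n∣ m n with ≤-total m n
... | inj₁ m≤n = m≤n⇒∣+m-+n∣≡∣m-n∣ m≤n
... | inj₂ n≤m = begin
  ℤ.∣ + m ℤ.- + n ∣ ≡⟨ ℤ.∣i-j∣≡∣j-i∣ (+ m) (+ n) ⟩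
  ℤ.∣ + n ℤ.- + m ∣ ≡⟨ m≤n⇒∣+m-+n∣≡∣m-n∣ n≤m ⟩
  ∣ n - m ∣         ≡⟨ ∣-∣-comm n m ⟩
  ∣ m - n ∣         ∎
  where open ≡-Reasoning

m∣n∧n<m⇒n≡0 : ∀ {m n} → m ∣ n → n < m → n ≡ 0
m∣n∧n<m⇒n≡0 {n = zero}  _   _   = refl
m∣n∧n<m⇒n≡0 {n = suc _} m∣n n<m = contradiction m∣n (>⇒∤ n<m)

diffDivides⇒∣-∣ : ∀ {f} → DiffDivides f → ∀ x y → ∣ x - y ∣ ∣ ∣ f x - f y ∣
diffDivides⇒∣-∣ {f} dd x y =
  subst₂ _∣_ (∣+m-+n∣≡∣m-n∣ x y) (∣+m-+n∣≡∣m-n∣ (f x) (f y)) (dd x y)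

eventuallyConstant⇒constant : ∀ {f t c} → DiffDivides f →
                              (∀ z → t ≤ z → f z ≡ c) → ∀ y → f y ≡ c
eventuallyConstant⇒constant {f} {t} {c} dd eventually y =
  ∣m-n∣≡0⇒m≡n (m∣n∧n<m⇒n≡0 w∣gap gap<w)
  where
  w : ℕ
  w = suc (f y + c) + t
  gap<w : ∣ f y - c ∣ < w
  gap<w = s≤s (begin
    ∣ f y - c ∣ ≤⟨ ∣m-n∣≤m⊔n (f y) c ⟩
    f y ⊔ c     ≤⟨ m⊔n≤m+n (f y) c ⟩
    f y + c     ≤⟨ m≤m+n (f y + c) t ⟩
    f y + c + t ∎)
    where open ≤-Reasoning
  w∣gap : w ∣ ∣ f y - c ∣
  w∣gap = subst₂ _∣_ (∣m-m+n∣≡n y w)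
                     (cong (∣ f y -_∣) (eventually (y + w) (m≤n⇒m≤o+n y (m≤n+m t _))))
                     (diffDivides⇒∣-∣ {f} dd y (y + w))

infix 4 _≡_[mod_]
_≡_[mod_] : ℕ → ℕ → ℤ → Set
a ≡ b [mod k ] = k ℤ∣.∣ (+ a ℤ.- + b)

mod-isCongruence : ∀ k → IsCongruence (λ a b → a ≡ b [mod k ])
mod-isCongruence k = record
  { isEquivalence = record
      { refl  = λ {a} → ≡-mod-refl a
      ; sym   = λ {a} {b} → ≡-mod-sym a b
      ; trans = λ {a} {b} {c} → ≡-mod-trans a b c
      }
  ; +-compat = λ {a} {b} {a′} {b′} → ≡-mod-+ a b a′ b′
  }
  where
  ≡-mod-refl : ∀ a → a ≡ a [mod k ]
  ≡-mod-refl a = subst (k ℤ∣.∣_) (sym (ℤ.+-inverseʳ (+ a))) (ℤ∣.divides ℤ.0ℤ refl)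

  ≡-mod-sym : ∀ a b → a ≡ b [mod k ] → b ≡ a [mod k ]
  ≡-mod-sym a b = subst (k ℤ∣.∣_) (neg-[i-j] (+ a) (+ b)) ∘′ ℤ∣.∣m⇒∣-m
    where
    neg-[i-j] : ∀ i j → ℤ.- (i ℤ.- j) ≡ j ℤ.- i
    neg-[i-j] = solve-∀

  ≡-mod-trans : ∀ a b c → a ≡ b [mod k ] → b ≡ c [mod k ] → a ≡ c [mod k ]
  ≡-mod-trans a b c p q =
    subst (k ℤ∣.∣_) (ℤ.+-minus-telescope (+ a) (+ b) (+ c)) (ℤ∣.∣m∣n⇒∣m+n p q)

  ≡-mod-+ : ∀ a b a′ b′ → a ≡ b [mod k ] → a′ ≡ b′ [mod k ] → a + a′ ≡ b + b′ [mod k ]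
  ≡-mod-+ a b a′ b′ p q = subst (k ℤ∣.∣_) [i-j]+[i′-j′]≡[i+i′]-[j+j′] (ℤ∣.∣m∣n⇒∣m+n p q)
    where
    interchange : ∀ i j i′ j′ → (i ℤ.- j) ℤ.+ (i′ ℤ.- j′) ≡ (i ℤ.+ i′) ℤ.- (j ℤ.+ j′)
    interchange = solve-∀
    [i-j]+[i′-j′]≡[i+i′]-[j+j′] : (+ a ℤ.- + b) ℤ.+ (+ a′ ℤ.- + b′) ≡ + (a + a′) ℤ.- + (b + b′)
    [i-j]+[i′-j′]≡[i+i′]-[j+j′] = trans (interchange (+ a) (+ b) (+ a′) (+ b′))
      (sym (cong₂ ℤ._-_ (ℤ.pos-+ a a′) (ℤ.pos-+ b b′)))

CollapseFrom : ℕ → Rel ℕ 0ℓ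
CollapseFrom t a b = a ≡ b ⊎ (t ≤ a × t ≤ b)

collapseFrom-isCongruence : ∀ t → IsCongruence (CollapseFrom t)
collapseFrom-isCongruence t = record
  { isEquivalence = record { refl = inj₁ refl ; sym = map sym swap ; trans = collapse-trans }
  ; +-compat      = collapse-+
  }
  where
  collapse-trans : ∀ {a b c} → CollapseFrom t a b → CollapseFrom t b c → CollapseFrom t a c
  collapse-trans (inj₁ refl)     b∼c             = b∼c
  collapse-trans a∼b             (inj₁ refl)     = a∼b
  collapse-trans (inj₂ (ta , _)) (inj₂ (_ , tc)) = inj₂ (ta , tc)

  collapse-+ : ∀ {a b a′ b′} → CollapseFrom t a b → CollapseFrom t a′ b′ →
               CollapseFrom t (a + a′) (b + b′)
  collapse-+ (inj₁ refl) (inj₁ refl) = inj₁ refl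
  collapse-+ {a′ = a′} {b′} (inj₂ (ta , tb)) _ =
    inj₂ (m≤n⇒m≤n+o a′ ta , m≤n⇒m≤n+o b′ tb)
  collapse-+ {a} {b} (inj₁ _) (inj₂ (ta′ , tb′)) =
    inj₂ (m≤n⇒m≤o+n a ta′ , m≤n⇒m≤o+n b tb′)

module _ {f : ℕ → ℕ} (preserves : CongruencePreserving f) where

  congruencePreserving⇒diffDivides : DiffDivides f
  congruencePreserving⇒diffDivides x y =
    ℤ∣.∣⇒∣ᵤ (preserves _ (mod-isCongruence (+ x ℤ.- + y)) x y ℤ∣.∣-refl)

  congruencePreserving⇒constantAbove : ∀ {t} → f t < t → ∀ z → t ≤ z → f z ≡ f t
  congruencePreserving⇒constantAbove {t} ft<t z t≤z
    with preserves (CollapseFrom t) (collapseFrom-isCongruence t) t z (inj₂ (≤-refl , t≤z))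
  ... | inj₁ ft≡fz       = sym ft≡fz
  ... | inj₂ (t≤ft , _) = contradiction t≤ft (<⇒≱ ft<t)

  congruencePreserving⇒constant : ∀ {t} → f t < t → IsConstant f
  congruencePreserving⇒constant {t} ft<t x y = trans (≡c x) (sym (≡c y))
    where
    ≡c : ∀ y → f y ≡ f t
    ≡c = eventuallyConstant⇒constant congruencePreserving⇒diffDivides
           (congruencePreserving⇒constantAbove ft<t)

  -- A constant f lies below the identity at 1 + f 0, so that single value decides the case.
  congruencePreserving⇒constant⊎extensive : IsConstant f ⊎ (∀ x → f x ≥ x)
  congruencePreserving⇒constant⊎extensive with f (suc (f 0)) <? suc (f 0)
  ... | yes below    = inj₁ (congruencePreserving⇒constant below)
  ... | no  notBelow = inj₂ λ x → ≮⇒≥ λ fx<x →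
    notBelow (subst (_< suc (f 0)) (congruencePreserving⇒constant fx<x 0 _) (n<1+n (f 0)))

module CongruenceProperties {_∼_ : Rel ℕ 0ℓ} (isCongruence : IsCongruence _∼_) where

  open IsCongruence isCongruence
  open IsEquivalence isEquivalence renaming (refl to ∼-refl; sym to ∼-sym; trans to ∼-trans)

  ∼-shift : ∀ {x d a} → x ∼ (x + d) → x ≤ a → a ∼ (a + d)
  ∼-shift {x} {d} x∼x+d x≤a with m≤n⇒∃[o]m+o≡n x≤a
  ... | k , refl = subst ((x + k) ∼_) (xy∙z≈xz∙y x d k) (+-compat x∼x+d (∼-refl {k}))

  ∼-shift-multiple : ∀ {x d a} → x ∼ (x + d) → x ≤ a → ∀ q → a ∼ (a + q * d)
  ∼-shift-multiple {a = a} _ _ zero = subst (a ∼_) (sym (+-identityʳ a)) ∼-refl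
  ∼-shift-multiple {d = d} {a} x∼x+d x≤a (suc q) =
    subst (a ∼_) (+-assoc a d (q * d))
      (∼-trans (∼-shift x∼x+d x≤a) (∼-shift-multiple x∼x+d (m≤n⇒m≤n+o d x≤a) q))

  ∼-shift-divisible : ∀ {x d u v} → x ∼ (x + d) → x ≤ u → u ≤ v → d ∣ ∣ u - v ∣ → u ∼ v
  ∼-shift-divisible {u = u} x∼x+d x≤u u≤v d∣∣u-v∣ with m≤n⇒∃[o]m+o≡n u≤v
  ... | e , refl with subst (_ ∣_) (∣m-m+n∣≡n u e) d∣∣u-v∣
  ... | divides q refl = ∼-shift-multiple x∼x+d x≤u q

  ∼-divisible : ∀ {x d u v} → x ∼ (x + d) → x ≤ u → x ≤ v → d ∣ ∣ u - v ∣ → u ∼ v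
  ∼-divisible {u = u} {v} x∼x+d x≤u x≤v d∣∣u-v∣ with ≤-total u v
  ... | inj₁ u≤v = ∼-shift-divisible x∼x+d x≤u u≤v d∣∣u-v∣
  ... | inj₂ v≤u = ∼-sym (∼-shift-divisible x∼x+d x≤v v≤u (subst (_ ∣_) (∣-∣-comm u v) d∣∣u-v∣))

  module _ {f : ℕ → ℕ} (dd : DiffDivides f) (extensive : ∀ x → f x ≥ x) where

    ≤∧∼⇒f∼f : ∀ {x y} → x ≤ y → x ∼ y → f x ∼ f y
    ≤∧∼⇒f∼f {x} x≤y x∼y with m≤n⇒∃[o]m+o≡n x≤y
    ... | d , refl = ∼-divisible x∼y (extensive x) (≤-trans (m≤m+n x d) (extensive (x + d)))
                       (subst (_∣ ∣ f x - f (x + d) ∣) (∣m-m+n∣≡n x d)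
                              (diffDivides⇒∣-∣ {f} dd x (x + d)))

    ∼⇒f∼f : ∀ {x y} → x ∼ y → f x ∼ f y
    ∼⇒f∼f {x} {y} x∼y with ≤-total x y
    ... | inj₁ x≤y = ≤∧∼⇒f∼f x≤y x∼y
    ... | inj₂ y≤x = ∼-sym (≤∧∼⇒f∼f y≤x (∼-sym x∼y))

diffDivides∧extensive⇒congruencePreserving : ∀ {f} → DiffDivides f → (∀ x → f x ≥ x) →
                                             CongruencePreserving f
diffDivides∧extensive⇒congruencePreserving dd extensive _ isCongruence _ _ =
  CongruenceProperties.∼⇒f∼f isCongruence dd extensive

constant⇒congruencePreserving : ∀ {f} → IsConstant f → CongruencePreserving f
constant⇒congruencePreserving {f} constant _∼_ isCongruence x y _ =
  subst (f x ∼_) (constant x y) (IsEquivalence.refl (IsCongruence.isEquivalence isCongruence))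

theorem3p12 : (f : ℕ → ℕ) → CongruencePreserving f ⇔ Condition2 f
theorem3p12 f = mk⇔
  (λ preserves → congruencePreserving⇒diffDivides preserves ,
                 congruencePreserving⇒constant⊎extensive preserves)
  λ where (dd , inj₁ constant)  → constant⇒congruencePreserving constant
          (dd , inj₂ extensive) → diffDivides∧extensive⇒congruencePreserving dd extensive
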